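{- Let $A,B\subseteq\mathbb{Z}$ be finite nonempty sets with $\min A=\min B=0$, $M=\max A$, $N=\max B$ and $M\geq N$. Let $x\in [1,N]\setminus B$. If $h_A\leq |B|-2$, then either $x\in A+B$ or $x+M\in A+B$.
   Context: For integers $a\le b$, $[a,b]=\{x\in\mathbb{Z}: a\le x\le b\}$. For $X\subseteq \mathbb{Z}$ finite nonempty, $h_X=|[\min X,\max X]\setminus X|$. $A+B=\{a+b:a\in A,b\in B\}$. -}

module Defs where

open import Data.Nat as ℕ using (ℕ)
open import Data.Integer as ℤ using (ℤ; +_; _+_; _-_; _≤_)
import Data.Integer.Properties as ℤP
open import Data.List using (List; []; map; filter; upTo; length)
open import Relation.Nullary using (yes; no)
open import Data.List.Membership.Propositional using (_∈_; _∉_)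
open import Data.List.Membership.DecPropositional ℤP._≟_ using (_∉?_)
open import Data.List.Relation.Unary.All using (All)
open import Data.List.Relation.Unary.Unique.Propositional using (Unique)
open import Data.Product using (Σ; ∃; _×_)
open import Relation.Binary.PropositionalEquality using (_≡_)

-- A finite set of integers is represented by a duplicate-free list;
-- its cardinality |X| is then the length of the list.
record FinSetℤ : Set where
  constructor mkSet
  field
    elems  : List ℤ
    unique : Unique elems
open FinSetℤ public

_∈ˢ_ : ℤ → FinSetℤ → Set
x ∈ˢ X = x ∈ elems X

card : FinSetℤ → ℕ
card X = length (elems X)

IsMin : FinSetℤ → ℤ → Set
IsMin X m = m ∈ˢ X × All (λ y → m ≤ y) (elems X)

IsMax : FinSetℤ → ℤ → Set
IsMax X m = m ∈ˢ X × All (λ y → y ≤ m) (elems X)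

interval : ℤ → ℤ → List ℤ
interval a b with a ℤ.≤? b
... | yes _ = map (λ k → a + + k) (upTo (ℕ.suc ℤ.∣ b - a ∣))
... | no  _ = []

-- h_X = |[min X, max X] \ X|, given the min m and max M of X
h : FinSetℤ → ℤ → ℤ → ℕ
h X m M = length (filter (λ y → y ∉? elems X) (interval m M))

_∈Sum_,_ : ℤ → FinSetℤ → FinSetℤ → Set
x ∈Sum A , B = ∃ λ a → ∃ λ b → a ∈ˢ A × b ∈ˢ B × a + b ≡ x

{-# OPTIONS --safe #-}
module Submission where

-- Suppose neither x nor x + M lies in A + B.  Reflect each b ∈ B to x − b when b < x and
-- to x + M − b when x < b < N: the image lies in [0, M] and avoids A, i.e. consists of gaps
-- of A, and the two branches never collide since the first lands in [0, x] and the second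
-- in (x, M].  Only b = N is left over, so |B| ≤ h_A + 1.

open import Defs
open import Data.Nat as ℕ using (ℕ)
open import Data.Integer as ℤ
  using (ℤ; +_; _+_; _-_; _≤_; _<_; 0ℤ; -1ℤ; _<?_; _≤?_; nonNegative)
import Data.Integer.Properties as ℤP
import Data.Nat.Properties as ℕP
open import Data.Integer.Tactic.RingSolver using (solve-∀)
open import Data.Product using (_×_; ∃; _,_)
open import Data.Sum using (_⊎_; inj₁; inj₂)
open import Data.Empty using (⊥)
open import Data.List using (List; []; _∷_; _++_; filter; length)
open import Data.List.Membership.Propositional using (_∈_; find; lose)
open import Data.List.Membership.Propositional.Properties
  using (∈-∃++; ∈-++⁻; ∈-++⁺ˡ; ∈-++⁺ʳ; ∈-filter⁺; ∈-map⁺; ∈-upTo⁺)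
open import Data.List.Membership.DecPropositional ℤP._≟_ using (_∉?_; _∈?_)
open import Data.List.Relation.Unary.Any using (here; there; any?)
import Data.List.Relation.Unary.All as All
open import Data.List.Relation.Unary.All using (All)
open import Data.List.Relation.Unary.AllPairs using (_∷_)
open import Data.List.Relation.Unary.Unique.Propositional using (Unique)
open import Data.List.Properties using (length-++)
open import Relation.Binary.Definitions using (tri<; tri≈; tri>)
open import Relation.Nullary using (Dec; yes; no; ¬_; contradiction)
open import Relation.Binary.PropositionalEquality

length-≤-of-injectiveOn : {A B : Set} (f : A → B) {xs : List A} {ys : List B} →
  Unique xs → (∀ {a b} → a ∈ xs → b ∈ xs → f a ≡ f b → a ≡ b) →
  (∀ {a} → a ∈ xs → f a ∈ ys) → length xs ℕ.≤ length ys
length-≤-of-injectiveOn f {[]} _ _ _ = ℕ.z≤n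
length-≤-of-injectiveOn f {a ∷ xs} (a∉xs ∷ xs!) injective maps
  with us , vs , refl ← ∈-∃++ (maps (here refl)) =
  ℕP.≤-trans (ℕ.s≤s (length-≤-of-injectiveOn f xs! injective′ maps′)) (ℕP.≤-reflexive length-eq)
  where
  injective′ : ∀ {b c} → b ∈ xs → c ∈ xs → f b ≡ f c → b ≡ c
  injective′ b∈ c∈ = injective (there b∈) (there c∈)

  maps′ : ∀ {b} → b ∈ xs → f b ∈ us ++ vs
  maps′ b∈ with ∈-++⁻ us (maps (there b∈))
  ... | inj₁ fb∈us         = ∈-++⁺ˡ fb∈us
  ... | inj₂ (here fb≡fa)  = contradiction (sym (injective (there b∈) (here refl) fb≡fa)) (All.lookup a∉xs b∈)
  ... | inj₂ (there fb∈vs) = ∈-++⁺ʳ us fb∈vs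

  length-eq : ℕ.suc (length (us ++ vs)) ≡ length (us ++ f a ∷ vs)
  length-eq rewrite length-++ us {vs} | length-++ us {f a ∷ vs} = sym (ℕP.+-suc (length us) (length vs))

i-j+j≡i : ∀ i j → (i - j) + j ≡ i
i-j+j≡i = solve-∀

i-[i-j]≡j : ∀ i j → i - (i - j) ≡ j
i-[i-j]≡j = solve-∀

i+j-i≡j : ∀ i j → (i + j) - i ≡ j
i+j-i≡j = solve-∀

i+j-j≡i : ∀ i j → (i + j) - j ≡ i
i+j-j≡i = solve-∀

minus-monoʳ-≤ : ∀ i {j k} → j ≤ k → i - k ≤ i - j
minus-monoʳ-≤ i j≤k = ℤP.+-monoʳ-≤ i (ℤP.neg-mono-≤ j≤k)

minus-monoʳ-< : ∀ i {j k} → j < k → i - k < i - j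
minus-monoʳ-< i j<k = ℤP.+-monoʳ-< i (ℤP.neg-mono-< j<k)

∈-interval⁺ : ∀ {a b v} → a ≤ v → v ≤ b → v ∈ interval a b
∈-interval⁺ {a} {b} {v} a≤v v≤b with a ≤? b
... | no a≰b = contradiction (ℤP.≤-trans a≤v v≤b) a≰b
... | yes _ = subst (_∈ _) a+∣v-a∣≡v
                (∈-map⁺ (λ k → a + + k) (∈-upTo⁺ (ℕ.s≤s (ℤP.drop‿+≤+ ∣v-a∣≤∣b-a∣))))
  where
  0≤v-a : 0ℤ ≤ v - a
  0≤v-a = ℤP.i≤j⇒0≤j-i a≤v

  ∣v-a∣≤∣b-a∣ : + ℤ.∣ v - a ∣ ≤ + ℤ.∣ b - a ∣
  ∣v-a∣≤∣b-a∣ rewrite ℤP.0≤i⇒+∣i∣≡i 0≤v-a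
                    | ℤP.0≤i⇒+∣i∣≡i (ℤP.≤-trans 0≤v-a (ℤP.+-monoˡ-≤ (ℤ.- a) v≤b))
                    = ℤP.+-monoˡ-≤ (ℤ.- a) v≤b

  a+∣v-a∣≡v : a + + ℤ.∣ v - a ∣ ≡ v
  a+∣v-a∣≡v rewrite ℤP.0≤i⇒+∣i∣≡i 0≤v-a = trans (ℤP.+-comm a (v - a)) (i-j+j≡i v a)

_∈Sum?_,_ : ∀ y A B → Dec (y ∈Sum A , B)
y ∈Sum? A , B with any? (λ a → (y - a) ∈? elems B) (elems A)
... | yes found = yes (witness (find found))
  where
  witness : ∃ (λ a → a ∈ elems A × (y - a) ∈ elems B) → y ∈Sum A , B
  witness (a , a∈A , y-a∈B) = a , y - a , a∈A , y-a∈B , trans (ℤP.+-comm a (y - a)) (i-j+j≡i y a)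
... | no none = no λ { (a , b , a∈A , b∈B , refl) →
        none (lose a∈A (subst (_∈ elems B) (sym (i+j-i≡j a b)) b∈B)) }

gaps : FinSetℤ → ℤ → ℤ → List ℤ
gaps X m M = filter (λ y → y ∉? elems X) (interval m M)

module Reflection (x M N : ℤ) where

  -- b = N is sent to −1, which lies outside [0, M]; it is the one element without a gap to go to.
  reflect : ℤ → ℤ
  reflect b with b <? x | b <? N
  ... | yes _ | _     = x - b
  ... | no _  | yes _ = (x + M) - b
  ... | no _  | no _  = -1ℤ

  unreflect : ℤ → ℤ
  unreflect v with v <? 0ℤ | v ≤? x
  ... | yes _ | _     = N
  ... | no _  | yes _ = x - v
  ... | no _  | no _  = (x + M) - v

  reflect-below : ∀ {b} → b < x → reflect b ≡ x - b
  reflect-below {b} b<x with b <? x | b <? N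
  ... | yes _   | _ = refl
  ... | no b≮x  | _ = contradiction b<x b≮x

  reflect-above : ∀ {b} → x < b → b < N → reflect b ≡ (x + M) - b
  reflect-above {b} x<b b<N with b <? x | b <? N
  ... | yes b<x | _       = contradiction b<x (ℤP.<-asym x<b)
  ... | no _    | yes _   = refl
  ... | no _    | no b≮N  = contradiction b<N b≮N

  reflect-top : x ≤ N → reflect N ≡ -1ℤ
  reflect-top x≤N with N <? x | N <? N
  ... | yes N<x | _      = contradiction x≤N (ℤP.<⇒≱ N<x)
  ... | no _    | yes N<N = contradiction N<N (ℤP.<-irrefl refl)
  ... | no _    | no _   = refl

  unreflect-≤ : ∀ {v} → 0ℤ ≤ v → v ≤ x → unreflect v ≡ x - v
  unreflect-≤ {v} 0≤v v≤x with v <? 0ℤ | v ≤? x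
  ... | yes v<0 | _      = contradiction 0≤v (ℤP.<⇒≱ v<0)
  ... | no _    | yes _  = refl
  ... | no _    | no v≰x = contradiction v≤x v≰x

  unreflect-> : ∀ {v} → 0ℤ ≤ v → x < v → unreflect v ≡ (x + M) - v
  unreflect-> {v} 0≤v x<v with v <? 0ℤ | v ≤? x
  ... | yes v<0 | _      = contradiction 0≤v (ℤP.<⇒≱ v<0)
  ... | no _    | yes v≤x = contradiction v≤x (ℤP.<⇒≱ x<v)
  ... | no _    | no _   = refl

  data Position (b : ℤ) : Set where
    below : b < x → Position b
    above : x < b → b < N → Position b
    top   : b ≡ N → Position b

  module _ (A B : FinSetℤ) (0≤x : 0ℤ ≤ x) (x≤N : x ≤ N) (N≤M : N ≤ M)
           (0≤B : All (0ℤ ≤_) (elems B)) (B≤N : All (_≤ N) (elems B)) (x∉B : ¬ x ∈ˢ B)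
           (x∉A+B : ¬ x ∈Sum A , B) (x+M∉A+B : ¬ (x + M) ∈Sum A , B) where

    position : ∀ {b} → b ∈ˢ B → Position b
    position {b} b∈B with ℤP.<-cmp b x
    ... | tri< b<x _ _ = below b<x
    ... | tri≈ _ b≡x _ = contradiction (subst (_∈ˢ B) b≡x b∈B) x∉B
    ... | tri> _ _ x<b with b <? N
    ...   | yes b<N = above x<b b<N
    ...   | no b≮N  = top (ℤP.≤-antisym (All.lookup B≤N b∈B) (ℤP.≮⇒≥ b≮N))

    below-range : ∀ {b} → b ∈ˢ B → b < x → 0ℤ ≤ x - b × x - b ≤ x
    below-range {b} b∈B b<x =
      ℤP.i≤j⇒0≤j-i (ℤP.<⇒≤ b<x) , ℤP.i-j≤i x b {{nonNegative (All.lookup 0≤B b∈B)}}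

    above-range : ∀ {b} → x < b → b < N → 0ℤ ≤ (x + M) - b × x < (x + M) - b × (x + M) - b ≤ M
    above-range {b} x<b b<N =
      ℤP.i≤j⇒0≤j-i (ℤP.≤-trans (ℤP.<⇒≤ b<M) (ℤP.i≤j+i M x {{nonNegative 0≤x}})) ,
      subst (_< (x + M) - b) (i+j-j≡i x M) (minus-monoʳ-< (x + M) b<M) ,
      subst ((x + M) - b ≤_) (i+j-i≡j x M) (minus-monoʳ-≤ (x + M) (ℤP.<⇒≤ x<b))
      where
      b<M : b < M
      b<M = ℤP.<-≤-trans b<N N≤M

    unreflect-reflect : ∀ {b} → b ∈ˢ B → unreflect (reflect b) ≡ b
    unreflect-reflect {b} b∈B with position b∈B
    ... | below b<x rewrite reflect-below b<x =
      let 0≤v , v≤x = below-range b∈B b<x in trans (unreflect-≤ 0≤v v≤x) (i-[i-j]≡j x b)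
    ... | above x<b b<N rewrite reflect-above x<b b<N =
      let 0≤v , x<v , _ = above-range x<b b<N in trans (unreflect-> 0≤v x<v) (i-[i-j]≡j (x + M) b)
    ... | top refl rewrite reflect-top x≤N = refl

    reflect-∈ : ∀ {b} → b ∈ˢ B → reflect b ∈ -1ℤ ∷ gaps A 0ℤ M
    reflect-∈ {b} b∈B with position b∈B
    ... | below b<x rewrite reflect-below b<x =
      let 0≤v , v≤x = below-range b∈B b<x in
      there (∈-filter⁺ _ (∈-interval⁺ 0≤v (ℤP.≤-trans v≤x (ℤP.≤-trans x≤N N≤M)))
                         (λ v∈A → x∉A+B (x - b , b , v∈A , b∈B , i-j+j≡i x b)))
    ... | above x<b b<N rewrite reflect-above x<b b<N =
      let 0≤v , _ , v≤M = above-range x<b b<N in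
      there (∈-filter⁺ _ (∈-interval⁺ 0≤v v≤M)
                         (λ v∈A → x+M∉A+B ((x + M) - b , b , v∈A , b∈B , i-j+j≡i (x + M) b)))
    ... | top refl rewrite reflect-top x≤N = here refl

    card≤1+h : card B ℕ.≤ ℕ.suc (h A 0ℤ M)
    card≤1+h = length-≤-of-injectiveOn reflect (unique B) reflect-injectiveOn reflect-∈
      where
      reflect-injectiveOn : ∀ {a b} → a ∈ˢ B → b ∈ˢ B → reflect a ≡ reflect b → a ≡ b
      reflect-injectiveOn a∈B b∈B eq =
        trans (sym (unreflect-reflect a∈B)) (trans (cong unreflect eq) (unreflect-reflect b∈B))

proposition2p3 : (A B : FinSetℤ) (M N x : ℤ) →
    IsMin A (+ 0) → IsMin B (+ 0) → IsMax A M → IsMax B N → N ≤ M →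
    (+ 1 ≤ x × x ≤ N) → (x ∈ˢ B → ⊥) →
    h A (+ 0) M ℕ.+ 2 ℕ.≤ card B →
    (x ∈Sum A , B) ⊎ ((x + M) ∈Sum A , B)
proposition2p3 A B M N x _ (_ , 0≤B) _ (_ , B≤N) N≤M (1≤x , x≤N) x∉B h+2≤card
  with x ∈Sum? A , B | (x + M) ∈Sum? A , B
... | yes x∈A+B | _             = inj₁ x∈A+B
... | no _      | yes x+M∈A+B   = inj₂ x+M∈A+B
... | no x∉A+B  | no x+M∉A+B    =
  contradiction (ℕP.≤-trans h+2≤card card≤1+h) (ℕP.<⇒≱ (ℕP.≤-reflexive (ℕP.+-comm 2 (h A 0ℤ M))))
  where
  card≤1+h : card B ℕ.≤ ℕ.suc (h A 0ℤ M)
  card≤1+h = Reflection.card≤1+h x M N A B (ℤP.≤-trans (ℤP.i≤suc[i] 0ℤ) 1≤x) x≤N N≤M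
               0≤B B≤N x∉B x∉A+B x+M∉A+B
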